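{- Let $G$ be a finite abstract simplicial complex, let $A'$ be the adjacency matrix of its connection graph $G'$, let $L' = 1 + A'$ (which is invertible) and let $g = (L')^{ -1}$ be its Green function. Then the super trace of $g$ equals the Euler characteristic: $$\mathrm{str}(g) = \sum_{x \in G} (-1)^{\dim(x)} g(x,x) = \chi(G).$$
   Context: A finite abstract simplicial complex $G$ is a finite collection of non-empty finite sets (faces) closed under taking non-empty subsets; $\dim(x)=|x|-1$ and $\chi(G)=\sum_{x\in G}(-1)^{\dim(x)}$. The connection graph $G'$ has vertex set $G$, two distinct faces being adjacent iff they have non-empty intersection. $A'$ is its adjacency matrix, indexed by faces, and $1$ denotes the identity matrix; $L'=1+A'$ is known to be invertible (indeed unimodular). For a matrix $A$ indexed by faces, $\mathrm{str}(A)=\sum_x (-1)^{\dim(x)}A_{xx}$. -}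

module Defs where

open import Data.Nat using (ℕ; zero; suc; _∸_)
open import Data.Fin using (Fin; zero; suc; _≟_)
open import Data.Fin.Subset using (Subset; _∩_; _⊆_; Nonempty; ∣_∣)
open import Data.Fin.Subset.Properties using (nonempty?)
open import Data.List using (List; length; lookup)
open import Data.List.Membership.Propositional using (_∈_)
open import Data.List.Relation.Unary.All using (All)
open import Data.List.Relation.Unary.Unique.Propositional using (Unique)
open import Data.Product using (_×_)
open import Data.Rational using (ℚ; 0ℚ; 1ℚ; _+_; _*_; -_)
open import Relation.Nullary using (yes; no)

IsSimplicialComplex : {n : ℕ} → List (Subset n) → Set
IsSimplicialComplex {n} G =
  Unique G
  × All Nonempty G
  × (∀ {x y : Subset n} → x ∈ G → Nonempty y → y ⊆ x → y ∈ G)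

face : {n : ℕ} (G : List (Subset n)) → Fin (length G) → Subset n
face G i = lookup G i

dim : {n : ℕ} → Subset n → ℕ
dim x = ∣ x ∣ ∸ 1

sgn : ℕ → ℚ
sgn zero    = 1ℚ
sgn (suc k) = - sgn k

Σ : (m : ℕ) → (Fin m → ℚ) → ℚ
Σ zero    f = 0ℚ
Σ (suc m) f = f zero + Σ m (λ i → f (suc i))

Matrix : ℕ → Set
Matrix m = Fin m → Fin m → ℚ

idM : (m : ℕ) → Matrix m
idM m i j with i ≟ j
... | yes _ = 1ℚ
... | no  _ = 0ℚ

_+M_ : {m : ℕ} → Matrix m → Matrix m → Matrix m
(A +M B) i j = A i j + B i j

_*M_ : {m : ℕ} → Matrix m → Matrix m → Matrix m
_*M_ {m} A B i j = Σ m (λ k → A i k * B k j)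

adjacency : {n : ℕ} (G : List (Subset n)) → Matrix (length G)
adjacency G i j with i ≟ j
... | yes _ = 0ℚ
... | no  _ with nonempty? (face G i ∩ face G j)
...   | yes _ = 1ℚ
...   | no  _ = 0ℚ

connectionLaplacian : {n : ℕ} (G : List (Subset n)) → Matrix (length G)
connectionLaplacian G = idM (length G) +M adjacency G

str : {n : ℕ} (G : List (Subset n)) → Matrix (length G) → ℚ
str G A = Σ (length G) (λ i → sgn (dim (face G i)) * A i i)

χ : {n : ℕ} → List (Subset n) → ℚ
χ G = Σ (length G) (λ i → sgn (dim (face G i)))

-- Let D x y = [y ⊆ x] on faces (below), U = Dᵀ (above) and W = diag((-1)^dim). Since G is
-- closed under non-empty subsets, the faces below a face x are exactly the non-empty
-- subsets of x, so sums over faces become sums over the Boolean lattice. There,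
-- Σ_{∅ ≠ z ⊆ s} (-1)^{dim z} = [s ≠ ∅] gives L' = D W U, and the alternating sum over an
-- interval, Σ_{w ⊆ z ⊆ x} (-1)^|z| = [w = x] (-1)^|w|, gives D W D = W = U W U. Hence D W
-- and U W are involutions, g = W U W D W, and cyclicity of the trace turns
-- str(g) = tr(W g) into tr(W L') = str(L'), which is χ(G) because L' has unit diagonal.

module Submission where

open import Defs
open import Algebra.Bundles using (CommutativeMonoid; Ring)
import Algebra.Properties.CommutativeSemigroup as CommutativeSemigroupProperties
import Algebra.Properties.Group as GroupProperties
import Algebra.Properties.Semiring.Sum as SemiringSum
open import Data.Bool using (Bool; true; false; _∧_)
import Data.Bool.Properties as Bool
open import Data.Fin using (Fin; zero; suc)
open import Data.Fin.Properties using (_≟_)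
open import Data.Fin.Subset using (Subset; outside; inside; _⊆_; _∩_; Nonempty; ∣_∣)
open import Data.Fin.Subset.Properties using (_⊆?_; nonempty?; ⊆-trans; p∩q⊆p; p∩q⊆q; x∈p∩q⁺; ∩-idem)
open import Data.List using (List; []; _∷_; length; lookup)
import Data.List.Membership.DecPropositional as DecMembership
open import Data.List.Membership.Propositional using (_∈_; _∉_)
open import Data.List.Membership.Propositional.Properties using (∈-lookup)
open import Data.List.Relation.Unary.All as All using (All)
open import Data.List.Relation.Unary.All.Properties.Core using (All¬⇒¬Any)
open import Data.List.Relation.Unary.AllPairs using (_∷_)
open import Data.List.Relation.Unary.Unique.Propositional using (Unique)
open import Data.Nat using (ℕ; zero; suc)
open import Data.Product using (_×_; _,_; proj₁; proj₂)
open import Data.Rational using (ℚ; 0ℚ; 1ℚ; _+_; _*_; -_)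
open import Data.Rational.Properties
  using ( +-identityˡ; +-identityʳ; +-inverseʳ; *-assoc; *-comm; *-identityˡ; *-identityʳ
        ; *-zeroˡ; *-zeroʳ; *-distribʳ-+; neg-distrib-+; neg-distribˡ-*; neg-distribʳ-*
        ; +-0-group; +-0-commutativeMonoid; *-1-commutativeMonoid; +-*-ring )
open import Data.Rational.Solver using (module +-*-Solver)
open import Data.Vec using ([]; _∷_; here; there)
open import Data.Vec.Properties using (≡-dec)
import Data.Vec.Functional.Relation.Binary.Equality.Setoid as Pointwise
open import Function using (_∘_)
open import Level using (0ℓ)
open import Relation.Binary.Bundles using (Setoid)
open import Relation.Binary.Definitions using (DecidableEquality)
open import Relation.Binary.PropositionalEquality
  using (_≡_; refl; sym; trans; cong; cong₂; subst; setoid; module ≡-Reasoning)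
import Relation.Binary.Reasoning.Setoid
open import Relation.Nullary using (Dec; yes; no; does; ¬_; ¬?; _×-dec_)
open import Relation.Nullary.Negation using (contradiction)

open +-*-Solver using (solve; _:*_; :-_; _:=_; con)

neg-involutive : ∀ p → - - p ≡ p
neg-involutive = GroupProperties.⁻¹-involutive +-0-group

open CommutativeSemigroupProperties (CommutativeMonoid.commutativeSemigroup *-1-commutativeMonoid)
  using (x∙yz≈z∙yx)
open CommutativeSemigroupProperties (CommutativeMonoid.commutativeSemigroup +-0-commutativeMonoid)
  using (interchange)

-- Iverson brackets

𝟙 : Bool → ℚ
𝟙 true  = 1ℚ
𝟙 false = 0ℚ

⟦_⟧ : {P : Set} → Dec P → ℚ
⟦ p? ⟧ = 𝟙 (does p?)

⟦⟧≡1 : {P : Set} (p? : Dec P) → P → ⟦ p? ⟧ ≡ 1ℚ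
⟦⟧≡1 (yes _) _ = refl
⟦⟧≡1 (no ¬p) p = contradiction p ¬p

⟦⟧≡0 : {P : Set} (p? : Dec P) → ¬ P → ⟦ p? ⟧ ≡ 0ℚ
⟦⟧≡0 (yes p) ¬p = contradiction p ¬p
⟦⟧≡0 (no _)  _  = refl

⟦⟧-cong : {P Q : Set} (p? : Dec P) (q? : Dec Q) → (P → Q) → (Q → P) → ⟦ p? ⟧ ≡ ⟦ q? ⟧
⟦⟧-cong (yes _) (yes _)  _ _ = refl
⟦⟧-cong (yes p) (no ¬q) f _ = contradiction (f p) ¬q
⟦⟧-cong (no ¬p) (yes q) _ g = contradiction (g q) ¬p
⟦⟧-cong (no _)  (no _)  _ _ = refl

⟦⟧-× : {P Q : Set} (p? : Dec P) (q? : Dec Q) → ⟦ p? ⟧ * ⟦ q? ⟧ ≡ ⟦ p? ×-dec q? ⟧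
⟦⟧-× p? q? = 𝟙-∧ (does p?) (does q?)
  where
  𝟙-∧ : ∀ a b → 𝟙 a * 𝟙 b ≡ 𝟙 (a ∧ b)
  𝟙-∧ true  true  = refl
  𝟙-∧ true  false = refl
  𝟙-∧ false true  = refl
  𝟙-∧ false false = refl

⟦⟧+⟦¬⟧ : {P : Set} (p? : Dec P) → ⟦ p? ⟧ + ⟦ ¬? p? ⟧ ≡ 1ℚ
⟦⟧+⟦¬⟧ (yes _) = refl
⟦⟧+⟦¬⟧ (no _)  = refl

-- Finite sums and square matrices

open SemiringSum (Ring.semiring +-*-ring)
  using (sum; sum-cong-≗; sum-replicate-zero; ∑-comm; *-distribˡ-sum; *-distribʳ-sum)

Σ≡sum : ∀ {m} (f : Fin m → ℚ) → Σ m f ≡ sum f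
Σ≡sum {zero}  f = refl
Σ≡sum {suc m} f = cong (f zero +_) (Σ≡sum (f ∘ suc))

module Sums {m : ℕ} where

  Σ-cong : {f g : Fin m → ℚ} → (∀ i → f i ≡ g i) → Σ m f ≡ Σ m g
  Σ-cong {f} {g} f≗g = trans (Σ≡sum f) (trans (sum-cong-≗ f≗g) (sym (Σ≡sum g)))

  Σ-zero : {f : Fin m → ℚ} → (∀ i → f i ≡ 0ℚ) → Σ m f ≡ 0ℚ
  Σ-zero f≗0 = trans (Σ-cong f≗0) (trans (Σ≡sum {m} (λ _ → 0ℚ)) (sum-replicate-zero m))

  *-distribˡ-Σ : ∀ c (f : Fin m → ℚ) → c * Σ m f ≡ Σ m (λ i → c * f i)
  *-distribˡ-Σ c f = trans (cong (c *_) (Σ≡sum f)) (trans (*-distribˡ-sum c f) (sym (Σ≡sum (λ i → c * f i))))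

  *-distribʳ-Σ : ∀ c (f : Fin m → ℚ) → Σ m f * c ≡ Σ m (λ i → f i * c)
  *-distribʳ-Σ c f = trans (cong (_* c) (Σ≡sum f)) (trans (*-distribʳ-sum c f) (sym (Σ≡sum (λ i → f i * c))))

  Σ-comm : ∀ {p} (f : Fin m → Fin p → ℚ) → Σ m (λ i → Σ p (f i)) ≡ Σ p (λ j → Σ m (λ i → f i j))
  Σ-comm {p} f = begin
    Σ m (λ i → Σ p (f i))             ≡⟨ Σ≡sum (λ i → Σ p (f i)) ⟩
    sum (λ i → Σ p (f i))             ≡⟨ sum-cong-≗ (Σ≡sum ∘ f) ⟩
    sum (λ i → sum (f i))             ≡⟨ ∑-comm f ⟩
    sum (λ j → sum (λ i → f i j))     ≡⟨ sum-cong-≗ (λ j → Σ≡sum (λ i → f i j)) ⟨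
    sum (λ j → Σ m (λ i → f i j))     ≡⟨ Σ≡sum (λ j → Σ m (λ i → f i j)) ⟨
    Σ p (λ j → Σ m (λ i → f i j))     ∎
    where open ≡-Reasoning

Σ-δ : ∀ {m} (i : Fin m) (f : Fin m → ℚ) → Σ m (λ k → ⟦ i ≟ k ⟧ * f k) ≡ f i
Σ-δ {suc m} zero f =
  trans (cong₂ _+_ (*-identityˡ (f zero)) (Sums.Σ-zero {m} (λ k → *-zeroˡ (f (suc k))))) (+-identityʳ (f zero))
Σ-δ (suc i) f =
  trans (cong (_+ Σ _ (λ k → ⟦ i ≟ k ⟧ * f (suc k))) (*-zeroˡ (f zero))) (trans (+-identityˡ _) (Σ-δ i (f ∘ suc)))

idM≡⟦≟⟧ : ∀ {m} (i j : Fin m) → idM m i j ≡ ⟦ i ≟ j ⟧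
idM≡⟦≟⟧ i j with i ≟ j
... | yes _ = refl
... | no  _ = refl

matrixSetoid : ℕ → Setoid 0ℓ 0ℓ
matrixSetoid m = Pointwise.≋-setoid (Pointwise.≋-setoid (setoid ℚ) m) m

infix 4 _≋_
_≋_ : ∀ {m} → Matrix m → Matrix m → Set
_≋_ {m} = Setoid._≈_ (matrixSetoid m)

diag : ∀ {m} → (Fin m → ℚ) → Matrix m
diag {m} d i j = d i * idM m i j

trace : ∀ {m} → Matrix m → ℚ
trace {m} A = Σ m (λ i → A i i)

module _ {m : ℕ} where

  open Sums {m}
  open Setoid (matrixSetoid m) using () renaming (refl to ≋-refl)

  *M-cong : {A A′ B B′ : Matrix m} → A ≋ A′ → B ≋ B′ → A *M B ≋ A′ *M B′
  *M-cong A≋A′ B≋B′ i j = Σ-cong (λ k → cong₂ _*_ (A≋A′ i k) (B≋B′ k j))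

  *M-assoc : (A B C : Matrix m) → (A *M B) *M C ≋ A *M (B *M C)
  *M-assoc A B C i j = begin
    Σ m (λ k → Σ m (λ l → A i l * B l k) * C k j)     ≡⟨ Σ-cong (λ k → *-distribʳ-Σ (C k j) _) ⟩
    Σ m (λ k → Σ m (λ l → (A i l * B l k) * C k j))   ≡⟨ Σ-comm (λ k l → (A i l * B l k) * C k j) ⟩
    Σ m (λ l → Σ m (λ k → (A i l * B l k) * C k j))   ≡⟨ Σ-cong (λ l → Σ-cong (λ k → *-assoc (A i l) _ _)) ⟩
    Σ m (λ l → Σ m (λ k → A i l * (B l k * C k j)))   ≡⟨ Σ-cong (λ l → *-distribˡ-Σ (A i l) _) ⟨
    Σ m (λ l → A i l * Σ m (λ k → B l k * C k j))     ∎
    where open ≡-Reasoning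

  *M-identityˡ : (A : Matrix m) → idM m *M A ≋ A
  *M-identityˡ A i j = trans (Σ-cong (λ k → cong (_* A k j) (idM≡⟦≟⟧ i k))) (Σ-δ i (λ k → A k j))

  *M-identityʳ : (A : Matrix m) → A *M idM m ≋ A
  *M-identityʳ A i j = trans (Σ-cong δ-comm) (Σ-δ j (A i))
    where
    δ-comm : ∀ k → A i k * idM m k j ≡ ⟦ j ≟ k ⟧ * A i k
    δ-comm k = trans (*-comm (A i k) _) (cong (_* A i k) (trans (idM≡⟦≟⟧ k j) (⟦⟧-cong (k ≟ j) (j ≟ k) sym sym)))

  diag-*M : (d : Fin m → ℚ) (A : Matrix m) → ∀ i j → (diag d *M A) i j ≡ d i * A i j
  diag-*M d A i j = begin
    Σ m (λ k → (d i * idM m i k) * A k j)   ≡⟨ Σ-cong (λ k → *-assoc (d i) _ _) ⟩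
    Σ m (λ k → d i * (idM m i k * A k j))   ≡⟨ *-distribˡ-Σ (d i) _ ⟨
    d i * (idM m *M A) i j                  ≡⟨ cong (d i *_) (*M-identityˡ A i j) ⟩
    d i * A i j                             ∎
    where open ≡-Reasoning

  diag-symmetric : (d : Fin m → ℚ) → ∀ i j → diag d i j ≡ diag d j i
  diag-symmetric d i j = begin
    d i * idM m i j   ≡⟨ cong (d i *_) (idM≡⟦≟⟧ i j) ⟩
    d i * ⟦ i ≟ j ⟧   ≡⟨ δ-transport ⟩
    d j * ⟦ i ≟ j ⟧   ≡⟨ cong (d j *_) (⟦⟧-cong (i ≟ j) (j ≟ i) sym sym) ⟩
    d j * ⟦ j ≟ i ⟧   ≡⟨ cong (d j *_) (idM≡⟦≟⟧ j i) ⟨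
    d j * idM m j i   ∎
    where
    open ≡-Reasoning
    δ-transport : d i * ⟦ i ≟ j ⟧ ≡ d j * ⟦ i ≟ j ⟧
    δ-transport with i ≟ j
    ... | yes refl = refl
    ... | no _     = trans (*-zeroʳ (d i)) (sym (*-zeroʳ (d j)))

  diag-involutive : (d : Fin m → ℚ) → (∀ i → d i * d i ≡ 1ℚ) → diag d *M diag d ≋ idM m
  diag-involutive d d²≡1 i j = begin
    (diag d *M diag d) i j    ≡⟨ diag-*M d (diag d) i j ⟩
    d i * (d i * idM m i j)   ≡⟨ *-assoc (d i) (d i) _ ⟨
    (d i * d i) * idM m i j   ≡⟨ cong (_* idM m i j) (d²≡1 i) ⟩
    1ℚ * idM m i j            ≡⟨ *-identityˡ _ ⟩
    idM m i j                 ∎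
    where open ≡-Reasoning

  trace-cong : {A B : Matrix m} → A ≋ B → trace A ≡ trace B
  trace-cong A≋B = Σ-cong (λ i → A≋B i i)

  trace-*M-comm : (A B : Matrix m) → trace (A *M B) ≡ trace (B *M A)
  trace-*M-comm A B = trans (Σ-comm (λ i k → A i k * B k i)) (Σ-cong (λ k → Σ-cong (λ i → *-comm (A i k) (B k i))))

  *M-congˡ : (A : Matrix m) {B B′ : Matrix m} → B ≋ B′ → A *M B ≋ A *M B′
  *M-congˡ A = *M-cong (≋-refl {A})

  *M-congʳ : (B : Matrix m) {A A′ : Matrix m} → A ≋ A′ → A *M B ≋ A′ *M B
  *M-congʳ B A≋A′ = *M-cong A≋A′ (≋-refl {B})

  left-inverse≋right-inverse : {L g h : Matrix m} → g *M L ≋ idM m → L *M h ≋ idM m → g ≋ h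
  left-inverse≋right-inverse {L} {g} {h} gL≋1 Lh≋1 = begin
    g                ≈⟨ *M-identityʳ g ⟨
    g *M idM m       ≈⟨ *M-congˡ g Lh≋1 ⟨
    g *M (L *M h)    ≈⟨ *M-assoc g L h ⟨
    (g *M L) *M h    ≈⟨ *M-congʳ h gL≋1 ⟩
    idM m *M h       ≈⟨ *M-identityˡ h ⟩
    h                ∎
    where open import Relation.Binary.Reasoning.Setoid (matrixSetoid m)

  *M-involutive : {W : Matrix m} (P : Matrix m) →
    W *M W ≋ idM m → P *M (W *M P) ≋ W → (P *M W) *M (P *M W) ≋ idM m
  *M-involutive {W} P W²≋1 PWP≋W = begin
    (P *M W) *M (P *M W)    ≈⟨ *M-assoc P W (P *M W) ⟩
    P *M (W *M (P *M W))    ≈⟨ *M-congˡ P (*M-assoc W P W) ⟨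
    P *M ((W *M P) *M W)    ≈⟨ *M-assoc P (W *M P) W ⟨
    (P *M (W *M P)) *M W    ≈⟨ *M-congʳ W PWP≋W ⟩
    W *M W                  ≈⟨ W²≋1 ⟩
    idM m                   ∎
    where open import Relation.Binary.Reasoning.Setoid (matrixSetoid m)

  trace-inverse : {W D U L g : Matrix m} →
    W *M W ≋ idM m → D *M (W *M D) ≋ W → U *M (W *M U) ≋ W → L ≋ D *M (W *M U) →
    g *M L ≋ idM m → trace (W *M g) ≡ trace (W *M L)
  trace-inverse {W} {D} {U} {L} {g} W²≋1 DWD≋W UWU≋W L≋DWU gL≋1 = begin
    trace (W *M g)     ≡⟨ trace-cong (*M-congˡ W (left-inverse≋right-inverse gL≋1 Lh≋1)) ⟩
    trace (W *M h)     ≡⟨ trace-cong Wh≋MN ⟩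
    trace (M *M N)     ≡⟨ trace-*M-comm M N ⟩
    trace (N *M M)     ≡⟨ trace-cong NM≋LW ⟩
    trace (L *M W)     ≡⟨ trace-*M-comm L W ⟩
    trace (W *M L)     ∎
    where
    open ≡-Reasoning
    module ≋ = Relation.Binary.Reasoning.Setoid (matrixSetoid m)
    N M h : Matrix m
    N = D *M W
    M = U *M W
    h = W *M (M *M N)

    Lh≋1 : L *M h ≋ idM m
    Lh≋1 = ≋.begin
      L *M h                      ≋.≈⟨ *M-congʳ h L≋DWU ⟩
      (D *M (W *M U)) *M h        ≋.≈⟨ *M-congʳ h (*M-assoc D W U) ⟨
      (N *M U) *M h               ≋.≈⟨ *M-assoc N U h ⟩
      N *M (U *M (W *M (M *M N))) ≋.≈⟨ *M-congˡ N (*M-assoc U W (M *M N)) ⟨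
      N *M (M *M (M *M N))        ≋.≈⟨ *M-congˡ N (*M-assoc M M N) ⟨
      N *M ((M *M M) *M N)        ≋.≈⟨ *M-congˡ N (*M-congʳ N (*M-involutive U W²≋1 UWU≋W)) ⟩
      N *M (idM m *M N)           ≋.≈⟨ *M-congˡ N (*M-identityˡ N) ⟩
      N *M N                      ≋.≈⟨ *M-involutive D W²≋1 DWD≋W ⟩
      idM m                       ≋.∎

    Wh≋MN : W *M h ≋ M *M N
    Wh≋MN = ≋.begin
      W *M (W *M (M *M N))        ≋.≈⟨ *M-assoc W W (M *M N) ⟨
      (W *M W) *M (M *M N)        ≋.≈⟨ *M-congʳ (M *M N) W²≋1 ⟩
      idM m *M (M *M N)           ≋.≈⟨ *M-identityˡ (M *M N) ⟩
      M *M N                      ≋.∎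

    NM≋LW : N *M M ≋ L *M W
    NM≋LW = ≋.begin
      (D *M W) *M (U *M W)        ≋.≈⟨ *M-assoc (D *M W) U W ⟨
      ((D *M W) *M U) *M W        ≋.≈⟨ *M-congʳ W (*M-assoc D W U) ⟩
      (D *M (W *M U)) *M W        ≋.≈⟨ *M-congʳ W L≋DWU ⟨
      L *M W                      ≋.∎

-- Alternating sums over the subsets of Fin n

sgn*sgn≡1 : ∀ k → sgn k * sgn k ≡ 1ℚ
sgn*sgn≡1 zero    = refl
sgn*sgn≡1 (suc k) = begin
  - sgn k * - sgn k       ≡⟨ neg-distribˡ-* (sgn k) (- sgn k) ⟨
  - (sgn k * - sgn k)     ≡⟨ cong -_ (neg-distribʳ-* (sgn k) (sgn k)) ⟨
  - - (sgn k * sgn k)     ≡⟨ neg-involutive _ ⟩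
  sgn k * sgn k           ≡⟨ sgn*sgn≡1 k ⟩
  1ℚ                      ∎
  where open ≡-Reasoning

-- dim uses truncated subtraction, so sgn (dim ∅) = 1 and nonemptiness is needed.
sgn-dim : ∀ {n} {p : Subset n} → Nonempty p → sgn (dim p) ≡ - sgn ∣ p ∣
sgn-dim {p = inside  ∷ p} _                          = sym (neg-involutive (sgn ∣ p ∣))
sgn-dim {p = outside ∷ p} (suc i , there i∈p) = sgn-dim (i , i∈p)

Nonempty-∷⁺ : ∀ {n} {x} {p : Subset n} → Nonempty p → Nonempty (x ∷ p)
Nonempty-∷⁺ (i , i∈p) = suc i , there i∈p

Nonempty-outside⁻ : ∀ {n} {p : Subset n} → Nonempty (outside ∷ p) → Nonempty p
Nonempty-outside⁻ (suc i , there i∈p) = i , i∈p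

⟦nonempty?-outside⟧ : ∀ {n} (p : Subset n) → ⟦ nonempty? (outside ∷ p) ⟧ ≡ ⟦ nonempty? p ⟧
⟦nonempty?-outside⟧ p = ⟦⟧-cong (nonempty? (outside ∷ p)) (nonempty? p) Nonempty-outside⁻ Nonempty-∷⁺

⟦nonempty?-inside⟧ : ∀ {n} (p : Subset n) → ⟦ nonempty? (inside ∷ p) ⟧ ≡ 1ℚ
⟦nonempty?-inside⟧ p = ⟦⟧≡1 (nonempty? (inside ∷ p)) (zero , here)

ΣSubset : (n : ℕ) → (Subset n → ℚ) → ℚ
ΣSubset zero    f = f []
ΣSubset (suc n) f = ΣSubset n (f ∘ (outside ∷_)) + ΣSubset n (f ∘ (inside ∷_))

ΣSubset-cong : ∀ n {f g : Subset n → ℚ} → (∀ b → f b ≡ g b) → ΣSubset n f ≡ ΣSubset n g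
ΣSubset-cong zero    f≗g = f≗g []
ΣSubset-cong (suc n) f≗g =
  cong₂ _+_ (ΣSubset-cong n (f≗g ∘ (outside ∷_))) (ΣSubset-cong n (f≗g ∘ (inside ∷_)))

ΣSubset-zero : ∀ n {f : Subset n → ℚ} → (∀ b → f b ≡ 0ℚ) → ΣSubset n f ≡ 0ℚ
ΣSubset-zero zero    f≗0 = f≗0 []
ΣSubset-zero (suc n) f≗0 =
  cong₂ _+_ (ΣSubset-zero n (f≗0 ∘ (outside ∷_))) (ΣSubset-zero n (f≗0 ∘ (inside ∷_)))

ΣSubset-distrib-+ : ∀ n (f g : Subset n → ℚ) → ΣSubset n (λ b → f b + g b) ≡ ΣSubset n f + ΣSubset n g
ΣSubset-distrib-+ zero    f g = refl
ΣSubset-distrib-+ (suc n) f g =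
  trans (cong₂ _+_ (ΣSubset-distrib-+ n (f ∘ out) (g ∘ out)) (ΣSubset-distrib-+ n (f ∘ in′) (g ∘ in′)))
        (interchange (ΣSubset n (f ∘ out)) (ΣSubset n (g ∘ out)) (ΣSubset n (f ∘ in′)) (ΣSubset n (g ∘ in′)))
  where
  out in′ : Subset n → Subset (suc n)
  out = outside ∷_
  in′ = inside ∷_

ΣSubset-neg : ∀ n (f : Subset n → ℚ) → ΣSubset n (λ b → - f b) ≡ - ΣSubset n f
ΣSubset-neg zero    f = refl
ΣSubset-neg (suc n) f =
  trans (cong₂ _+_ (ΣSubset-neg n (f ∘ (outside ∷_))) (ΣSubset-neg n (f ∘ (inside ∷_))))
        (sym (neg-distrib-+ (ΣSubset n (f ∘ (outside ∷_))) (ΣSubset n (f ∘ (inside ∷_)))))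

infix 4 _≟ˢ_
_≟ˢ_ : ∀ {n} → DecidableEquality (Subset n)
_≟ˢ_ = ≡-dec Bool._≟_

ΣSubset-δ : ∀ {n} (a : Subset n) (f : Subset n → ℚ) → ΣSubset n (λ b → ⟦ b ≟ˢ a ⟧ * f b) ≡ f a
ΣSubset-δ [] f = *-identityˡ (f [])
ΣSubset-δ (outside ∷ a) f =
  trans (cong₂ _+_ (ΣSubset-δ a _) (ΣSubset-zero _ (λ b → *-zeroˡ (f (inside ∷ b))))) (+-identityʳ _)
ΣSubset-δ (inside ∷ a) f =
  trans (cong₂ _+_ (ΣSubset-zero _ (λ b → *-zeroˡ (f (outside ∷ b)))) (ΣSubset-δ a _)) (+-identityˡ _)

ΣSubset-sgn : ∀ {n} (s : Subset n) → ΣSubset n (λ b → ⟦ b ⊆? s ⟧ * sgn ∣ b ∣) ≡ ⟦ ¬? (nonempty? s) ⟧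
ΣSubset-sgn [] = refl
ΣSubset-sgn {suc n} (outside ∷ s) = begin
  ΣSubset n (λ b → ⟦ b ⊆? s ⟧ * sgn ∣ b ∣) + ΣSubset n (λ b → 0ℚ * - sgn ∣ b ∣)
    ≡⟨ cong₂ _+_ (ΣSubset-sgn s) (ΣSubset-zero n (λ b → *-zeroˡ (- sgn ∣ b ∣))) ⟩
  ⟦ ¬? (nonempty? s) ⟧ + 0ℚ
    ≡⟨ +-identityʳ _ ⟩
  ⟦ ¬? (nonempty? s) ⟧
    ≡⟨ ⟦⟧-cong (¬? (nonempty? s)) (¬? (nonempty? (outside ∷ s)))
         (λ ¬ne ne → ¬ne (Nonempty-outside⁻ ne)) (λ ¬ne ne → ¬ne (Nonempty-∷⁺ ne)) ⟩
  ⟦ ¬? (nonempty? (outside ∷ s)) ⟧ ∎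
  where open ≡-Reasoning
ΣSubset-sgn {suc n} (inside ∷ s) = begin
  S + ΣSubset n (λ b → ⟦ b ⊆? s ⟧ * - sgn ∣ b ∣)
    ≡⟨ cong (S +_) (trans (ΣSubset-cong n (λ b → sym (neg-distribʳ-* ⟦ b ⊆? s ⟧ (sgn ∣ b ∣)))) (ΣSubset-neg n _)) ⟩
  S + - S
    ≡⟨ +-inverseʳ S ⟩
  0ℚ
    ≡⟨ ⟦⟧≡0 (¬? (nonempty? (inside ∷ s))) (λ ¬ne → ¬ne (zero , here)) ⟨
  ⟦ ¬? (nonempty? (inside ∷ s)) ⟧ ∎
  where
  open ≡-Reasoning
  S : ℚ
  S = ΣSubset n (λ b → ⟦ b ⊆? s ⟧ * sgn ∣ b ∣)

ΣSubset-sgn-dim : ∀ {n} (s : Subset n) →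
  ΣSubset n (λ b → ⟦ b ⊆? s ⟧ * (⟦ nonempty? b ⟧ * sgn (dim b))) ≡ ⟦ nonempty? s ⟧
ΣSubset-sgn-dim [] = refl
ΣSubset-sgn-dim {suc n} (x ∷ s) = begin
  ΣSubset n (λ b → ⟦ b ⊆? s ⟧ * (⟦ nonempty? (outside ∷ b) ⟧ * sgn (dim b))) + R x
    ≡⟨ cong (_+ R x) (trans (ΣSubset-cong n drop-outside) (ΣSubset-sgn-dim s)) ⟩
  ⟦ nonempty? s ⟧ + R x
    ≡⟨ cases x ⟩
  ⟦ nonempty? (x ∷ s) ⟧ ∎
  where
  open ≡-Reasoning
  R : Bool → ℚ
  R x = ΣSubset n (λ b → ⟦ inside ∷ b ⊆? x ∷ s ⟧ * (⟦ nonempty? (inside ∷ b) ⟧ * sgn ∣ b ∣))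

  drop-outside : ∀ b → ⟦ b ⊆? s ⟧ * (⟦ nonempty? (outside ∷ b) ⟧ * sgn (dim b))
                     ≡ ⟦ b ⊆? s ⟧ * (⟦ nonempty? b ⟧ * sgn (dim b))
  drop-outside b = cong (λ t → ⟦ b ⊆? s ⟧ * (t * sgn (dim b))) (⟦nonempty?-outside⟧ b)

  cases : ∀ x → ⟦ nonempty? s ⟧ + R x ≡ ⟦ nonempty? (x ∷ s) ⟧
  cases outside = begin
    ⟦ nonempty? s ⟧ + R outside
      ≡⟨ cong (⟦ nonempty? s ⟧ +_) (ΣSubset-zero n (λ b → *-zeroˡ (⟦ nonempty? (inside ∷ b) ⟧ * sgn ∣ b ∣))) ⟩
    ⟦ nonempty? s ⟧ + 0ℚ
      ≡⟨ +-identityʳ _ ⟩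
    ⟦ nonempty? s ⟧
      ≡⟨ ⟦nonempty?-outside⟧ s ⟨
    ⟦ nonempty? (outside ∷ s) ⟧ ∎
  cases inside = begin
    ⟦ nonempty? s ⟧ + R inside
      ≡⟨ cong (⟦ nonempty? s ⟧ +_) (ΣSubset-cong n drop-inside) ⟩
    ⟦ nonempty? s ⟧ + ΣSubset n (λ b → ⟦ b ⊆? s ⟧ * sgn ∣ b ∣)
      ≡⟨ cong (⟦ nonempty? s ⟧ +_) (ΣSubset-sgn s) ⟩
    ⟦ nonempty? s ⟧ + ⟦ ¬? (nonempty? s) ⟧
      ≡⟨ ⟦⟧+⟦¬⟧ (nonempty? s) ⟩
    1ℚ
      ≡⟨ ⟦nonempty?-inside⟧ s ⟨
    ⟦ nonempty? (inside ∷ s) ⟧ ∎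
    where
    drop-inside : ∀ b → ⟦ b ⊆? s ⟧ * (⟦ nonempty? (inside ∷ b) ⟧ * sgn ∣ b ∣) ≡ ⟦ b ⊆? s ⟧ * sgn ∣ b ∣
    drop-inside b = cong (⟦ b ⊆? s ⟧ *_) (trans (cong (_* sgn ∣ b ∣) (⟦nonempty?-inside⟧ b)) (*-identityˡ _))

x*[0*y]≡0 : ∀ x y → x * (0ℚ * y) ≡ 0ℚ
x*[0*y]≡0 x y = trans (cong (x *_) (*-zeroˡ y)) (*-zeroʳ x)

x*[y*-z]≡-[x*[y*z]] : ∀ x y z → x * (y * - z) ≡ - (x * (y * z))
x*[y*-z]≡-[x*[y*z]] = solve 3 (λ x y z → x :* (y :* (:- z)) := :- (x :* (y :* z))) refl

ΣSubset-interval-sgn : ∀ {n} (w x : Subset n) →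
  ΣSubset n (λ b → ⟦ w ⊆? b ⟧ * (⟦ b ⊆? x ⟧ * sgn ∣ b ∣)) ≡ ⟦ w ≟ˢ x ⟧ * sgn ∣ w ∣
ΣSubset-interval-sgn [] [] = refl
ΣSubset-interval-sgn {suc n} (outside ∷ w) (outside ∷ x) =
  trans (cong₂ _+_ (ΣSubset-interval-sgn w x) (ΣSubset-zero n (λ b → x*[0*y]≡0 ⟦ w ⊆? b ⟧ (- sgn ∣ b ∣))))
        (+-identityʳ _)
ΣSubset-interval-sgn {suc n} (outside ∷ w) (inside ∷ x) = begin
  T + ΣSubset n (λ b → ⟦ w ⊆? b ⟧ * (⟦ b ⊆? x ⟧ * - sgn ∣ b ∣))
    ≡⟨ cong (T +_) (trans (ΣSubset-cong n (λ b → x*[y*-z]≡-[x*[y*z]] ⟦ w ⊆? b ⟧ ⟦ b ⊆? x ⟧ (sgn ∣ b ∣)))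
                           (ΣSubset-neg n (λ b → ⟦ w ⊆? b ⟧ * (⟦ b ⊆? x ⟧ * sgn ∣ b ∣)))) ⟩
  T + - T ≡⟨ +-inverseʳ T ⟩
  0ℚ      ≡⟨ *-zeroˡ (sgn ∣ w ∣) ⟨
  0ℚ * sgn ∣ w ∣ ∎
  where
  open ≡-Reasoning
  T : ℚ
  T = ΣSubset n (λ b → ⟦ w ⊆? b ⟧ * (⟦ b ⊆? x ⟧ * sgn ∣ b ∣))
ΣSubset-interval-sgn {suc n} (inside ∷ w) (outside ∷ x) =
  trans (cong₂ _+_ (ΣSubset-zero n (λ b → *-zeroˡ (⟦ b ⊆? x ⟧ * sgn ∣ b ∣)))
                   (ΣSubset-zero n (λ b → x*[0*y]≡0 ⟦ w ⊆? b ⟧ (- sgn ∣ b ∣))))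
        (sym (*-zeroˡ (- sgn ∣ w ∣)))
ΣSubset-interval-sgn {suc n} (inside ∷ w) (inside ∷ x) = begin
  ΣSubset n (λ b → 0ℚ * (⟦ b ⊆? x ⟧ * sgn ∣ b ∣)) + ΣSubset n (λ b → ⟦ w ⊆? b ⟧ * (⟦ b ⊆? x ⟧ * - sgn ∣ b ∣))
    ≡⟨ cong₂ _+_ (ΣSubset-zero n (λ b → *-zeroˡ (⟦ b ⊆? x ⟧ * sgn ∣ b ∣)))
                 (ΣSubset-cong n (λ b → x*[y*-z]≡-[x*[y*z]] ⟦ w ⊆? b ⟧ ⟦ b ⊆? x ⟧ (sgn ∣ b ∣))) ⟩
  0ℚ + ΣSubset n (λ b → - T b)
    ≡⟨ trans (+-identityˡ _) (ΣSubset-neg n T) ⟩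
  - ΣSubset n T
    ≡⟨ cong -_ (ΣSubset-interval-sgn w x) ⟩
  - (⟦ w ≟ˢ x ⟧ * sgn ∣ w ∣)
    ≡⟨ neg-distribʳ-* ⟦ w ≟ˢ x ⟧ (sgn ∣ w ∣) ⟩
  ⟦ w ≟ˢ x ⟧ * - sgn ∣ w ∣ ∎
  where
  open ≡-Reasoning
  T : Subset n → ℚ
  T b = ⟦ w ⊆? b ⟧ * (⟦ b ⊆? x ⟧ * sgn ∣ b ∣)

-- Sums over a duplicate-free list of subsets

infix 4 _∈?_
_∈?_ : ∀ {n} (b : Subset n) (xs : List (Subset n)) → Dec (b ∈ xs)
_∈?_ = DecMembership._∈?_ _≟ˢ_

⟦∈?-∷⟧ : ∀ {n} {a : Subset n} {xs} → a ∉ xs → ∀ b → ⟦ b ∈? a ∷ xs ⟧ ≡ ⟦ b ≟ˢ a ⟧ + ⟦ b ∈? xs ⟧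
⟦∈?-∷⟧ {a = a} {xs} a∉xs b with b ≟ˢ a | b ∈? xs
... | yes refl | yes a∈xs = contradiction a∈xs a∉xs
... | yes refl | no _     = refl
... | no _     | yes _    = refl
... | no _     | no _     = refl

Σ-lookup≡ΣSubset : ∀ {n} (xs : List (Subset n)) → Unique xs → (φ : Subset n → ℚ) →
  Σ (length xs) (φ ∘ lookup xs) ≡ ΣSubset n (λ b → ⟦ b ∈? xs ⟧ * φ b)
Σ-lookup≡ΣSubset {n} [] _ φ = sym (ΣSubset-zero n (λ b → *-zeroˡ (φ b)))
Σ-lookup≡ΣSubset {n} (a ∷ xs) (a∉xs ∷ xs-unique) φ = begin
  φ a + Σ (length xs) (φ ∘ lookup xs)
    ≡⟨ cong₂ _+_ (sym (ΣSubset-δ a φ)) (Σ-lookup≡ΣSubset xs xs-unique φ) ⟩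
  ΣSubset n (λ b → ⟦ b ≟ˢ a ⟧ * φ b) + ΣSubset n (λ b → ⟦ b ∈? xs ⟧ * φ b)
    ≡⟨ ΣSubset-distrib-+ n (λ b → ⟦ b ≟ˢ a ⟧ * φ b) (λ b → ⟦ b ∈? xs ⟧ * φ b) ⟨
  ΣSubset n (λ b → ⟦ b ≟ˢ a ⟧ * φ b + ⟦ b ∈? xs ⟧ * φ b)
    ≡⟨ ΣSubset-cong n (λ b → trans (cong (_* φ b) (⟦∈?-∷⟧ (All¬⇒¬Any a∉xs) b))
                                   (*-distribʳ-+ (φ b) ⟦ b ≟ˢ a ⟧ ⟦ b ∈? xs ⟧)) ⟨
  ΣSubset n (λ b → ⟦ b ∈? a ∷ xs ⟧ * φ b) ∎
  where open ≡-Reasoning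

lookup-injective : ∀ {A : Set} {xs : List A} → Unique xs → ∀ i j → lookup xs i ≡ lookup xs j → i ≡ j
lookup-injective {xs = x ∷ xs} _ zero zero _ = refl
lookup-injective {xs = x ∷ xs} (x∉xs ∷ _) zero (suc j) x≡xⱼ =
  contradiction (subst (_∈ xs) (sym x≡xⱼ) (∈-lookup j)) (All¬⇒¬Any x∉xs)
lookup-injective {xs = x ∷ xs} (x∉xs ∷ _) (suc i) zero xᵢ≡x =
  contradiction (subst (_∈ xs) xᵢ≡x (∈-lookup i)) (All¬⇒¬Any x∉xs)
lookup-injective {xs = x ∷ xs} (_ ∷ xs-unique) (suc i) (suc j) xᵢ≡xⱼ =
  cong suc (lookup-injective xs-unique i j xᵢ≡xⱼ)

⟦⊆?∩⟧ : ∀ {n} (c p q : Subset n) → ⟦ c ⊆? p ∩ q ⟧ ≡ ⟦ c ⊆? p ⟧ * ⟦ c ⊆? q ⟧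
⟦⊆?∩⟧ c p q = trans (⟦⟧-cong (c ⊆? p ∩ q) ((c ⊆? p) ×-dec (c ⊆? q)) split join) (sym (⟦⟧-× (c ⊆? p) (c ⊆? q)))
  where
  split : c ⊆ p ∩ q → c ⊆ p × c ⊆ q
  split c⊆p∩q = ⊆-trans c⊆p∩q (p∩q⊆p p q) , ⊆-trans c⊆p∩q (p∩q⊆q p q)
  join : c ⊆ p × c ⊆ q → c ⊆ p ∩ q
  join (c⊆p , c⊆q) i∈c = x∈p∩q⁺ (c⊆p i∈c , c⊆q i∈c)

sgn-dim-above-nonempty : ∀ {n} {w : Subset n} → Nonempty w → ∀ x c →
  ⟦ nonempty? c ⟧ * (⟦ c ⊆? x ⟧ * (sgn (dim c) * ⟦ w ⊆? c ⟧)) ≡ - (⟦ w ⊆? c ⟧ * (⟦ c ⊆? x ⟧ * sgn ∣ c ∣))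
sgn-dim-above-nonempty {w = w} (i , i∈w) x c with w ⊆? c
... | yes w⊆c = begin
  ⟦ nonempty? c ⟧ * (⟦ c ⊆? x ⟧ * (sgn (dim c) * 1ℚ))
    ≡⟨ cong₂ (λ t u → t * (⟦ c ⊆? x ⟧ * (u * 1ℚ))) (⟦⟧≡1 (nonempty? c) c-nonempty) (sgn-dim c-nonempty) ⟩
  1ℚ * (⟦ c ⊆? x ⟧ * (- sgn ∣ c ∣ * 1ℚ))
    ≡⟨ solve 2 (λ X s → con 1ℚ :* (X :* (:- s :* con 1ℚ)) := :- (con 1ℚ :* (X :* s))) refl
         ⟦ c ⊆? x ⟧ (sgn ∣ c ∣) ⟩
  - (1ℚ * (⟦ c ⊆? x ⟧ * sgn ∣ c ∣)) ∎
  where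
  open ≡-Reasoning
  c-nonempty : Nonempty c
  c-nonempty = i , w⊆c i∈w
... | no _ =
  solve 4 (λ N X s t → N :* (X :* (s :* con 0ℚ)) := :- (con 0ℚ :* (X :* t))) refl
    ⟦ nonempty? c ⟧ ⟦ c ⊆? x ⟧ (sgn (dim c)) (sgn ∣ c ∣)

-- The connection Laplacian of a simplicial complex

module _ {n : ℕ} (G : List (Subset n)) (sc : IsSimplicialComplex G) where

  open Sums {length G}

  private
    faces-unique : Unique G
    faces-unique = proj₁ sc

    faces-nonempty : All Nonempty G
    faces-nonempty = proj₁ (proj₂ sc)

    faces-closed : ∀ {x y : Subset n} → x ∈ G → Nonempty y → y ⊆ x → y ∈ G
    faces-closed = proj₂ (proj₂ sc)

  sign : Fin (length G) → ℚ
  sign k = sgn (dim (face G k))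

  below above : Matrix (length G)
  below i k = ⟦ face G k ⊆? face G i ⟧
  above i k = ⟦ face G i ⊆? face G k ⟧

  face-nonempty : ∀ i → Nonempty (face G i)
  face-nonempty i = All.lookup faces-nonempty (∈-lookup i)

  ⟦∈?⟧-below-face : ∀ {x} → x ∈ G → ∀ c → ⟦ c ∈? G ⟧ * ⟦ c ⊆? x ⟧ ≡ ⟦ nonempty? c ⟧ * ⟦ c ⊆? x ⟧
  ⟦∈?⟧-below-face {x} x∈G c = begin
    ⟦ c ∈? G ⟧ * ⟦ c ⊆? x ⟧                  ≡⟨ ⟦⟧-× (c ∈? G) (c ⊆? x) ⟩
    ⟦ (c ∈? G) ×-dec (c ⊆? x) ⟧              ≡⟨ ⟦⟧-cong ((c ∈? G) ×-dec (c ⊆? x)) ((nonempty? c) ×-dec (c ⊆? x))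
                                                  (λ (c∈G , c⊆x) → All.lookup faces-nonempty c∈G , c⊆x)
                                                  (λ (c-nonempty , c⊆x) → faces-closed x∈G c-nonempty c⊆x , c⊆x) ⟩
    ⟦ (nonempty? c) ×-dec (c ⊆? x) ⟧         ≡⟨ ⟦⟧-× (nonempty? c) (c ⊆? x) ⟨
    ⟦ nonempty? c ⟧ * ⟦ c ⊆? x ⟧             ∎
    where open ≡-Reasoning

  Σ-faces-below : ∀ {x} → x ∈ G → (φ : Subset n → ℚ) →
    Σ (length G) (λ k → ⟦ face G k ⊆? x ⟧ * φ (face G k))
      ≡ ΣSubset n (λ c → ⟦ nonempty? c ⟧ * (⟦ c ⊆? x ⟧ * φ c))
  Σ-faces-below {x} x∈G φ =
    trans (Σ-lookup≡ΣSubset G faces-unique (λ c → ⟦ c ⊆? x ⟧ * φ c)) (ΣSubset-cong n regroup)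
    where
    regroup : ∀ c → ⟦ c ∈? G ⟧ * (⟦ c ⊆? x ⟧ * φ c) ≡ ⟦ nonempty? c ⟧ * (⟦ c ⊆? x ⟧ * φ c)
    regroup c = begin
      ⟦ c ∈? G ⟧ * (⟦ c ⊆? x ⟧ * φ c)          ≡⟨ *-assoc ⟦ c ∈? G ⟧ ⟦ c ⊆? x ⟧ (φ c) ⟨
      (⟦ c ∈? G ⟧ * ⟦ c ⊆? x ⟧) * φ c          ≡⟨ cong (_* φ c) (⟦∈?⟧-below-face x∈G c) ⟩
      (⟦ nonempty? c ⟧ * ⟦ c ⊆? x ⟧) * φ c     ≡⟨ *-assoc ⟦ nonempty? c ⟧ ⟦ c ⊆? x ⟧ (φ c) ⟩
      ⟦ nonempty? c ⟧ * (⟦ c ⊆? x ⟧ * φ c)     ∎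
      where open ≡-Reasoning

  face∩face-nonempty : ∀ i → Nonempty (face G i ∩ face G i)
  face∩face-nonempty i = subst Nonempty (sym (∩-idem (face G i))) (face-nonempty i)

  connectionLaplacian≡⟦nonempty?∩⟧ : ∀ i j → connectionLaplacian G i j ≡ ⟦ nonempty? (face G i ∩ face G j) ⟧
  connectionLaplacian≡⟦nonempty?∩⟧ i j with i ≟ j
  ... | yes refl = sym (⟦⟧≡1 (nonempty? (face G i ∩ face G i)) (face∩face-nonempty i))
  ... | no _ with nonempty? (face G i ∩ face G j)
  ...   | yes _ = refl
  ...   | no _  = refl

  connectionLaplacian≋below*sign*above : connectionLaplacian G ≋ below *M (diag sign *M above)
  connectionLaplacian≋below*sign*above i j = begin
    connectionLaplacian G i j
      ≡⟨ connectionLaplacian≡⟦nonempty?∩⟧ i j ⟩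
    ⟦ nonempty? (x ∩ y) ⟧
      ≡⟨ ΣSubset-sgn-dim (x ∩ y) ⟨
    ΣSubset n (λ c → ⟦ c ⊆? x ∩ y ⟧ * (⟦ nonempty? c ⟧ * sgn (dim c)))
      ≡⟨ ΣSubset-cong n regroup ⟩
    ΣSubset n (λ c → ⟦ nonempty? c ⟧ * (⟦ c ⊆? x ⟧ * (sgn (dim c) * ⟦ c ⊆? y ⟧)))
      ≡⟨ Σ-faces-below (∈-lookup i) (λ c → sgn (dim c) * ⟦ c ⊆? y ⟧) ⟨
    Σ (length G) (λ k → below i k * (sign k * above k j))
      ≡⟨ Σ-cong (λ k → cong (below i k *_) (diag-*M sign above k j)) ⟨
    (below *M (diag sign *M above)) i j ∎
    where
    open ≡-Reasoning
    x y : Subset n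
    x = face G i
    y = face G j
    regroup : ∀ c → ⟦ c ⊆? x ∩ y ⟧ * (⟦ nonempty? c ⟧ * sgn (dim c))
                  ≡ ⟦ nonempty? c ⟧ * (⟦ c ⊆? x ⟧ * (sgn (dim c) * ⟦ c ⊆? y ⟧))
    regroup c = trans (cong (_* (⟦ nonempty? c ⟧ * sgn (dim c))) (⟦⊆?∩⟧ c x y))
      (solve 4 (λ a b N s → (a :* b) :* (N :* s) := N :* (a :* (s :* b))) refl
        ⟦ c ⊆? x ⟧ ⟦ c ⊆? y ⟧ ⟦ nonempty? c ⟧ (sgn (dim c)))

  interval-sum : ∀ a b → Σ (length G) (λ k → above a k * (sign k * above k b)) ≡ sign a * idM (length G) a b
  interval-sum a b = begin
    Σ (length G) (λ k → above a k * (sign k * above k b))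
      ≡⟨ Σ-cong (λ k → x∙yz≈z∙yx (above a k) (sign k) (above k b)) ⟩
    Σ (length G) (λ k → ⟦ face G k ⊆? y ⟧ * (sign k * ⟦ x ⊆? face G k ⟧))
      ≡⟨ Σ-faces-below (∈-lookup b) (λ c → sgn (dim c) * ⟦ x ⊆? c ⟧) ⟩
    ΣSubset n (λ c → ⟦ nonempty? c ⟧ * (⟦ c ⊆? y ⟧ * (sgn (dim c) * ⟦ x ⊆? c ⟧)))
      ≡⟨ ΣSubset-cong n (sgn-dim-above-nonempty (face-nonempty a) y) ⟩
    ΣSubset n (λ c → - (⟦ x ⊆? c ⟧ * (⟦ c ⊆? y ⟧ * sgn ∣ c ∣)))
      ≡⟨ ΣSubset-neg n (λ c → ⟦ x ⊆? c ⟧ * (⟦ c ⊆? y ⟧ * sgn ∣ c ∣)) ⟩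
    - ΣSubset n (λ c → ⟦ x ⊆? c ⟧ * (⟦ c ⊆? y ⟧ * sgn ∣ c ∣))
      ≡⟨ cong -_ (ΣSubset-interval-sgn x y) ⟩
    - (⟦ x ≟ˢ y ⟧ * sgn ∣ x ∣)
      ≡⟨ neg-distribʳ-* ⟦ x ≟ˢ y ⟧ (sgn ∣ x ∣) ⟩
    ⟦ x ≟ˢ y ⟧ * - sgn ∣ x ∣
      ≡⟨ cong₂ _*_ (⟦⟧-cong (a ≟ b) (x ≟ˢ y) (cong (face G)) (lookup-injective faces-unique a b))
                   (sgn-dim (face-nonempty a)) ⟨
    ⟦ a ≟ b ⟧ * sign a
      ≡⟨ trans (cong (sign a *_) (idM≡⟦≟⟧ a b)) (*-comm (sign a) ⟦ a ≟ b ⟧) ⟨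
    sign a * idM (length G) a b ∎
    where
    open ≡-Reasoning
    x y : Subset n
    x = face G a
    y = face G b

  above*sign*above≋sign : above *M (diag sign *M above) ≋ diag sign
  above*sign*above≋sign i j =
    trans (Σ-cong (λ k → cong (above i k *_) (diag-*M sign above k j))) (interval-sum i j)

  below*sign*below≋sign : below *M (diag sign *M below) ≋ diag sign
  below*sign*below≋sign i j = begin
    Σ (length G) (λ k → below i k * (diag sign *M below) k j)
      ≡⟨ Σ-cong (λ k → trans (cong (below i k *_) (diag-*M sign below k j))
                             (x∙yz≈z∙yx (below i k) (sign k) (below k j))) ⟩
    Σ (length G) (λ k → above j k * (sign k * above k i))
      ≡⟨ interval-sum j i ⟩
    diag sign j i
      ≡⟨ diag-symmetric sign j i ⟩
    diag sign i j ∎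
    where open ≡-Reasoning

  sign*sign≋1 : diag sign *M diag sign ≋ idM (length G)
  sign*sign≋1 = diag-involutive sign (λ i → sgn*sgn≡1 (dim (face G i)))

  str≡trace : ∀ A → str G A ≡ trace (diag sign *M A)
  str≡trace A = Σ-cong (λ i → sym (diag-*M sign A i i))

  str-connectionLaplacian : str G (connectionLaplacian G) ≡ χ G
  str-connectionLaplacian = Σ-cong (λ i → trans (cong (sign i *_) (diagonal≡1 i)) (*-identityʳ (sign i)))
    where
    diagonal≡1 : ∀ i → connectionLaplacian G i i ≡ 1ℚ
    diagonal≡1 i = trans (connectionLaplacian≡⟦nonempty?∩⟧ i i)
                         (⟦⟧≡1 (nonempty? (face G i ∩ face G i)) (face∩face-nonempty i))

corollary1 : (n : ℕ) (G : List (Subset n)) → IsSimplicialComplex G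
    → (g : Matrix (length G))
    → (∀ i j → (connectionLaplacian G *M g) i j ≡ idM (length G) i j)
    → (∀ i j → (g *M connectionLaplacian G) i j ≡ idM (length G) i j)
    → str G g ≡ χ G
corollary1 n G sc g _ g*L≋1 = begin
  str G g                 ≡⟨ str≡trace G sc g ⟩
  trace (W *M g)          ≡⟨ trace-inverse {D = below G sc} {U = above G sc} (sign*sign≋1 G sc)
                               (below*sign*below≋sign G sc) (above*sign*above≋sign G sc)
                               (connectionLaplacian≋below*sign*above G sc) g*L≋1 ⟩
  trace (W *M L)          ≡⟨ str≡trace G sc L ⟨
  str G L                 ≡⟨ str-connectionLaplacian G sc ⟩
  χ G                     ∎
  where
  open ≡-Reasoning
  W L : Matrix (length G)
  W = diag (sign G sc)
  L = connectionLaplacian G
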